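{- Let $s\ge 2$ and $t$ be integers, and let $r\ge 2$ be an integer with $\gcd(r,s)=1$. If $r$ is distinguished with respect to $(s,t)$, then $r$ is distinguished with respect to $(s,\gcd(t,s-1))$.
   Context: For integers $s$ and $r\ge 1$ with $\gcd(r,s)=1$, $\operatorname{ord}_r(s)$ denotes the least positive integer $m$ with $s^m\equiv 1\pmod r$. For integers $s\ge 2$ and $t$, an integer $r\ge 2$ is distinguished with respect to $(s,t)$ if $\gcd(r,s)=1$ and $r$ divides $t\cdot\frac{s^{\operatorname{ord}_r(s)}-1}{s-1}$. -}

module Defs where

open import Data.Nat using (ℕ; suc; _∸_; _^_; _≤_; _<_; _/_)
import Data.Nat as ℕ
open import Data.Nat.Divisibility using (_∣_)
open import Data.Nat.GCD using (gcd)
open import Data.Integer using (ℤ; +_)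
import Data.Integer as ℤ
import Data.Integer.Divisibility as ℤd
open import Data.Product using (Σ; _×_)
open import Relation.Nullary using (¬_)
open import Relation.Binary.PropositionalEquality using (_≡_)

-- ord_r(s) = m : m is the least positive integer with s^m ≡ 1 (mod r),
-- i.e. r ∣ s^m - 1 (for s ≥ 1, s^m ∸ 1 is the true difference).
IsOrd : (r s m : ℕ) → Set
IsOrd r s m = (1 ≤ m) × (r ∣ (s ^ m ∸ 1))
            × (∀ k → 1 ≤ k → k < m → ¬ (r ∣ (s ^ k ∸ 1)))

-- (s^m - 1)/(s - 1), exact natural-number quotient (divisor s - 1 nonzero for s ≥ 2)
geomQuot : (s m : ℕ) → ℕ
geomQuot 0 m = 0
geomQuot 1 m = 0
geomQuot (suc (suc k)) m = (suc (suc k) ^ m ∸ 1) / suc k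

-- r distinguished w.r.t. (s,t): gcd(r,s)=1 and r ∣ t * (s^{ord_r(s)}-1)/(s-1)
-- (the order is unique, so quantifying over m with IsOrd r s m names ord_r(s)).
Distinguished : (s : ℕ) (t : ℤ) (r : ℕ) → Set
Distinguished s t r = (2 ≤ r) × (gcd r s ≡ 1)
  × Σ ℕ (λ m → IsOrd r s m × ((+ r) ℤd.∣ (t ℤ.* (+ geomQuot s m))))

{-# OPTIONS --safe #-}
-- Since (s - 1) · (s^m - 1)/(s - 1) = s^m - 1 and r ∣ s^m - 1 for m = ord_r(s),
-- r divides both t · Q and (s - 1) · Q, where Q = (s^m - 1)/(s - 1); hence
-- it divides their gcd, which is gcd(t, s - 1) · Q.
module Submission where

open import Defs
open import Data.Nat using (ℕ; zero; suc; _+_; _*_; _^_; _∸_; _≤_; s≤s)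
open import Data.Nat.Properties using (*-comm; *-zeroʳ)
open import Data.Nat.Divisibility using (_∣_; divides)
open import Data.Nat.DivMod using (m*[n/m]≡n)
open import Data.Nat.GCD using (gcd; gcd-greatest; c*gcd[m,n]≡gcd[cm,cn])
open import Data.Nat.Tactic.RingSolver using (solve-∀)
open import Data.Integer using (ℤ; +_; ∣_∣)
open import Data.Integer.Properties using (abs-*)
open import Data.Product using (_,_)
open import Relation.Binary.PropositionalEquality using (_≡_; sym; trans; cong; cong₂; subst)

repunit : (b m : ℕ) → ℕ
repunit b zero    = 0
repunit b (suc m) = b * repunit b m + 1

^≡1+pred*repunit : ∀ b m → suc b ^ m ≡ 1 + b * repunit (suc b) m
^≡1+pred*repunit b zero    = cong suc (sym (*-zeroʳ b))
^≡1+pred*repunit b (suc m) rewrite ^≡1+pred*repunit b m = horner b (repunit (suc b) m)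
  where
  horner : ∀ b g → suc b * (1 + b * g) ≡ 1 + b * (suc b * g + 1)
  horner = solve-∀

pred∣^∸1 : ∀ b m → b ∣ suc b ^ m ∸ 1
pred∣^∸1 b m = divides (repunit (suc b) m)
  (trans (cong (_∸ 1) (^≡1+pred*repunit b m)) (*-comm b _))

pred*geomQuot≡^∸1 : ∀ k m → suc k * geomQuot (suc (suc k)) m ≡ suc (suc k) ^ m ∸ 1
pred*geomQuot≡^∸1 k m = m*[n/m]≡n (pred∣^∸1 (suc k) m)

∣-gcd-*ʳ : ∀ {r a b c} → r ∣ a * c → r ∣ b * c → r ∣ gcd a b * c
∣-gcd-*ʳ {r} {a} {b} {c} r∣ac r∣bc = subst (r ∣_) gcd[ac,bc]≡gcd[a,b]*c
  (gcd-greatest r∣ac r∣bc)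
  where
  gcd[ac,bc]≡gcd[a,b]*c : gcd (a * c) (b * c) ≡ gcd a b * c
  gcd[ac,bc]≡gcd[a,b]*c = trans (cong₂ gcd (*-comm a c) (*-comm b c))
    (trans (sym (c*gcd[m,n]≡gcd[cm,cn] c a b)) (*-comm c _))

lemma3p1 : (s : ℕ) (t : ℤ) (r : ℕ) → 2 ≤ s → 2 ≤ r → gcd r s ≡ 1
    → Distinguished s t r → Distinguished s (+ gcd ∣ t ∣ (s ∸ 1)) r
lemma3p1 (suc (suc k)) t r (s≤s (s≤s _)) _ _ (2≤r , coprime , m , ord@(_ , r∣sᵐ∸1 , _) , r∣tQ) =
  2≤r , coprime , m , ord , subst (r ∣_) (sym (abs-* (+ gcd (∣ t ∣) (suc k)) (+ Q))) r∣gcdQ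
  where
  Q : ℕ
  Q = geomQuot (suc (suc k)) m

  r∣∣t∣Q : r ∣ ∣ t ∣ * Q
  r∣∣t∣Q = subst (r ∣_) (abs-* t (+ Q)) r∣tQ

  r∣predQ : r ∣ suc k * Q
  r∣predQ = subst (r ∣_) (sym (pred*geomQuot≡^∸1 k m)) r∣sᵐ∸1

  r∣gcdQ : r ∣ gcd (∣ t ∣) (suc k) * Q
  r∣gcdQ = ∣-gcd-*ʳ {a = ∣ t ∣} r∣∣t∣Q r∣predQ
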